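{- Let $n,k,r,q$ be integers with $n\ge2k\ge2$, $q\ge1$ and $0\le r\le k-1$. Let $n_1,\ldots,n_t$ be integers such that $n=\sum_{i=1}^t n_i$ and $2k\le n_i<4k$ for all $i$. Then $$\chi_{qk-r}(K(n,k))\ge qn-\sum_{i=1}^t\Bigl\lfloor\frac{n_ir}{k}\Bigr\rfloor.$$
   Context: For integers $n\ge k\ge 1$, the Kneser graph $K(n,k)$ has as vertices all $k$-element subsets of $[n]=\{1,\dots,n\}$, two vertices being adjacent iff the subsets are disjoint. A graph $G$ is $(n,k)$-colourable if each vertex can be assigned a $k$-subset of $[n]$ so that adjacent vertices receive disjoint subsets. The $k$-th multi-chromatic number $\chi_k(G)$ is the smallest $n$ such that $G$ is $(n,k)$-colourable. -}

module Defs where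

open import Level using (Level; suc; _⊔_)
open import Data.Nat using (ℕ; _*_; _≤_; NonZero; s≤s; z≤n)
open import Data.Nat.DivMod using (_/_)
open import Data.Fin.Subset using (Subset; ∣_∣; _∩_; Empty)
open import Data.List using (List; map)
open import Data.Nat.ListAction using (sum)
open import Relation.Binary.PropositionalEquality using (_≡_)

record Graph (a ℓ : Level) : Set (suc (a ⊔ ℓ)) where
  field
    Vertex : Set a
    Adj    : Vertex → Vertex → Set ℓ

open Graph public

KSubset : ℕ → ℕ → Set
KSubset n k = Σ' where
  open import Data.Product using (Σ)
  Σ' = Σ (Subset n) (λ s → ∣ s ∣ ≡ k)

Disjoint : {n : ℕ} → Subset n → Subset n → Set
Disjoint p q = Empty (p ∩ q)

Kneser : ℕ → ℕ → Graph _ _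
Kneser n k = record
  { Vertex = KSubset n k
  ; Adj    = λ u v → Disjoint (Data.Product.proj₁ u) (Data.Product.proj₁ v)
  }
  where import Data.Product

record Colouring {a ℓ} (G : Graph a ℓ) (N m : ℕ) : Set (a ⊔ ℓ) where
  field
    colour   : Vertex G → Subset N
    size     : ∀ v → ∣ colour v ∣ ≡ m
    proper   : ∀ u v → Adj G u v → Disjoint (colour u) (colour v)

Colourable : ∀ {a ℓ} → Graph a ℓ → ℕ → ℕ → Set (a ⊔ ℓ)
Colourable G N m = Colouring G N m

2≤2k⇒NonZero : ∀ {k} → 2 ≤ 2 * k → NonZero k
2≤2k⇒NonZero {ℕ.zero} ()
2≤2k⇒NonZero {ℕ.suc k} _ = _

floorSum : (ns : List ℕ) (r k : ℕ) → .{{NonZero k}} → ℕ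
floorSum ns r k = sum (map (λ ni → (ni * r) / k) ns)

{-# OPTIONS --safe #-}
-- Cut [n] into consecutive windows of sizes nᵢ and read each window as a cycle. For a fixed
-- colour c, the arcs of k consecutive positions of a window whose colour sets contain c pairwise
-- intersect (disjoint arcs are adjacent in K(n, k)), so by Katona's circle argument there are at
-- most k of them. Double counting the pairs (arc, colour) of a window gives nᵢ(qk − r) ≤ k uᵢ,
-- where uᵢ is the number of colours used on its arcs, i.e. uᵢ ≥ qnᵢ − ⌊nᵢr/k⌋. Arcs of different
-- windows are disjoint, so no colour is used by two windows, and Σ uᵢ ≤ N.
module Submission where

open import Defs
open import Data.Bool using (Bool; true; false; T; _∧_)
open import Data.Bool.Properties using (T-≡; T-∧)
open import Data.Empty using (⊥; ⊥-elim)
open import Data.Fin using (Fin; toℕ; zero; suc)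
open import Data.Fin.Subset using (Subset; ∣_∣; _∩_; _∈_; Nonempty; inside; outside)
open import Data.Fin.Subset.Properties using (x∈p∩q⁻)
open import Data.List using (List; []; _∷_)
open import Data.List.Relation.Unary.All as All using (All; []; _∷_)
open import Data.Nat
  using (ℕ; zero; suc; _+_; _*_; _∸_; _≤_; _<_; z≤n; s≤s; s≤s⁻¹; z<s; s<s; _<ᵇ_; _≤ᵇ_;
         NonZero; >-nonZero; >-nonZero⁻¹)
open import Data.Nat.DivMod
  using (_%_; _/_; m%n<n; m≡m%n+[m/n]*n; m<n⇒m%n≡m; [m+n]%n≡m%n; %-distribˡ-+)
open import Data.Nat.ListAction using (sum)
open import Data.Nat.Properties
open import Algebra.Properties.CommutativeSemigroup +-commutativeSemigroup
  using (interchange; xy∙z≈xz∙y)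
open import Data.Nat.Tactic.RingSolver using (solve-∀)
open import Data.Product using (_×_; ∃-syntax; _,_; proj₁; proj₂)
open import Data.Product.Properties using (Σ-≡,≡→≡)
open import Data.Sum using (_⊎_; inj₁; inj₂)
open import Data.Vec using ([]; _∷_; tabulate; here; there)
open import Data.Vec.Properties using (lookup∘tabulate; []=⇒lookup; tabulate-cong)
open import Function using (_∘_; Equivalence)
open import Relation.Binary.PropositionalEquality
  using (_≡_; refl; sym; trans; cong; cong₂; subst; module ≡-Reasoning)
open import Relation.Nullary using (¬_)

-- Sums over initial segments of ℕ

infix 10 ∑
∑ : ℕ → (ℕ → ℕ) → ℕ
∑ zero    f = 0
∑ (suc n) f = f 0 + ∑ n (f ∘ suc)

syntax ∑ n (λ i → x) = ∑[ i < n ] x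

∑-cong : ∀ n {f g : ℕ → ℕ} → (∀ {i} → i < n → f i ≡ g i) → ∑ n f ≡ ∑ n g
∑-cong zero    f≗g = refl
∑-cong (suc n) f≗g = cong₂ _+_ (f≗g z<s) (∑-cong n (f≗g ∘ s<s))

∑-mono-≤ : ∀ n {f g : ℕ → ℕ} → (∀ {i} → i < n → f i ≤ g i) → ∑ n f ≤ ∑ n g
∑-mono-≤ zero    f≤g = z≤n
∑-mono-≤ (suc n) f≤g = +-mono-≤ (f≤g z<s) (∑-mono-≤ n (f≤g ∘ s<s))

∑-const : ∀ n c → ∑[ i < n ] c ≡ n * c
∑-const zero    c = refl
∑-const (suc n) c = cong (c +_) (∑-const n c)

∑-≡0 : ∀ n {f : ℕ → ℕ} → (∀ {i} → i < n → f i ≡ 0) → ∑ n f ≡ 0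
∑-≡0 n f≡0 = trans (∑-cong n f≡0) (trans (∑-const n 0) (*-zeroʳ n))

∑-≤1 : ∀ n {f : ℕ → ℕ} → (∀ {i} → i < n → f i ≤ 1) → ∑ n f ≤ n
∑-≤1 zero    f≤1 = z≤n
∑-≤1 (suc n) f≤1 = +-mono-≤ (f≤1 z<s) (∑-≤1 n (f≤1 ∘ s<s))

∑-split : ∀ m n (f : ℕ → ℕ) → ∑ (m + n) f ≡ ∑ m f + ∑[ i < n ] f (m + i)
∑-split zero    n f = refl
∑-split (suc m) n f = trans (cong (f 0 +_) (∑-split m n (f ∘ suc))) (sym (+-assoc (f 0) _ _))

∑-snoc : ∀ n (f : ℕ → ℕ) → ∑ (suc n) f ≡ ∑ n f + f n
∑-snoc zero    f = +-comm (f 0) 0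
∑-snoc (suc n) f = trans (cong (f 0 +_) (∑-snoc n (f ∘ suc))) (sym (+-assoc (f 0) _ _))

∑-distrib-+ : ∀ n (f g : ℕ → ℕ) → ∑[ i < n ] (f i + g i) ≡ ∑ n f + ∑ n g
∑-distrib-+ zero    f g = refl
∑-distrib-+ (suc n) f g =
  trans (cong (f 0 + g 0 +_) (∑-distrib-+ n (f ∘ suc) (g ∘ suc))) (interchange (f 0) (g 0) _ _)

*-distribˡ-∑ : ∀ c n (f : ℕ → ℕ) → c * ∑ n f ≡ ∑[ i < n ] (c * f i)
*-distribˡ-∑ c zero    f = *-zeroʳ c
*-distribˡ-∑ c (suc n) f = trans (*-distribˡ-+ c (f 0) _) (cong (c * f 0 +_) (*-distribˡ-∑ c n (f ∘ suc)))

∑-comm : ∀ m n (f : ℕ → ℕ → ℕ) → ∑[ i < m ] ∑[ j < n ] f i j ≡ ∑[ j < n ] ∑[ i < m ] f i j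
∑-comm zero    n f = sym (∑-≡0 n (λ _ → refl))
∑-comm (suc m) n f = trans (cong (∑ n (f 0) +_) (∑-comm m n (f ∘ suc)))
                          (sym (∑-distrib-+ n (f 0) (λ j → ∑[ i < m ] f (suc i) j)))

∑-rotate : ∀ n (f : ℕ → ℕ) → (∀ i → f (i + n) ≡ f i) → ∀ a → ∑[ i < n ] f (a + i) ≡ ∑ n f
∑-rotate n f periodic zero    = refl
∑-rotate n f periodic (suc a) = trans (∑-rotate n (f ∘ suc) (periodic ∘ suc) a) rotate₁
  where
  open ≡-Reasoning
  rotate₁ : ∑ n (f ∘ suc) ≡ ∑ n f
  rotate₁ = +-cancelˡ-≡ (f 0) _ _ (begin
    ∑ (suc n) f   ≡⟨ ∑-snoc n f ⟩
    ∑ n f + f n   ≡⟨ cong (∑ n f +_) (periodic 0) ⟩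
    ∑ n f + f 0   ≡⟨ +-comm (∑ n f) (f 0) ⟩
    f 0 + ∑ n f   ∎)

𝟙 : Bool → ℕ
𝟙 true  = 1
𝟙 false = 0

𝟙≤1 : ∀ b → 𝟙 b ≤ 1
𝟙≤1 true  = s≤s z≤n
𝟙≤1 false = z≤n

¬T⇒𝟙≡0 : ∀ {b} → ¬ T b → 𝟙 b ≡ 0
¬T⇒𝟙≡0 {true}  ¬b = ⊥-elim (¬b _)
¬T⇒𝟙≡0 {false} ¬b = refl

m≤n⇒m≤n*𝟙[0<m] : ∀ {m n} → m ≤ n → m ≤ n * 𝟙 (0 <ᵇ m)
m≤n⇒m≤n*𝟙[0<m] {zero}  _   = z≤n
m≤n⇒m≤n*𝟙[0<m] {suc m} {n} m≤n = subst (suc m ≤_) (sym (*-identityʳ n)) m≤n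

𝟙-exclusive : ∀ {a b} → (T a → T b → ⊥) → 𝟙 a + 𝟙 b ≤ 1
𝟙-exclusive {true}  {true}  excl = ⊥-elim (excl _ _)
𝟙-exclusive {true}  {false} excl = s≤s z≤n
𝟙-exclusive {false} {b}     excl = 𝟙≤1 b

∑𝟙≡0⊎∃T : ∀ n (g : ℕ → Bool) → ∑[ i < n ] 𝟙 (g i) ≡ 0 ⊎ ∃[ i ] T (g i)
∑𝟙≡0⊎∃T zero    g = inj₁ refl
∑𝟙≡0⊎∃T (suc n) g with g 0 in g0
... | true  = inj₂ (0 , subst T (sym g0) _)
... | false with ∑𝟙≡0⊎∃T n (g ∘ suc)
...   | inj₁ ∑≡0       = inj₁ ∑≡0
...   | inj₂ (i , gi) = inj₂ (suc i , gi)

∑𝟙<ᵇ : ∀ {k L} → k ≤ L → ∑[ y < L ] 𝟙 (y <ᵇ k) ≡ k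
∑𝟙<ᵇ {zero}  {L}     _         = ∑-≡0 L (λ _ → refl)
∑𝟙<ᵇ {suc k} {suc L} (s≤s k≤L) = cong suc (∑𝟙<ᵇ k≤L)

∑𝟙<ᵇ∧ : ∀ {L m} (h : ℕ → Bool) → L ≤ m → ∑[ y < m ] 𝟙 ((y <ᵇ L) ∧ h y) ≡ ∑[ y < L ] 𝟙 (h y)
∑𝟙<ᵇ∧ {zero}  {m}     h _         = ∑-≡0 m (λ _ → refl)
∑𝟙<ᵇ∧ {suc L} {suc m} h (s≤s L≤m) = cong (𝟙 (h 0) +_) (∑𝟙<ᵇ∧ (h ∘ suc) L≤m)

∑𝟙≤ᵇ∧ : ∀ o {m} (g : ℕ → Bool) → ∑[ z < o + m ] 𝟙 ((o ≤ᵇ z) ∧ g (z ∸ o)) ≡ ∑[ y < m ] 𝟙 (g y)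
∑𝟙≤ᵇ∧ zero    g = refl
∑𝟙≤ᵇ∧ (suc o) {m} g =
  trans (∑-cong (o + m) (λ {z} _ → cong (λ b → 𝟙 (b ∧ g (z ∸ o))) (<ᵇ-suc o z))) (∑𝟙≤ᵇ∧ o g)
  where
  <ᵇ-suc : ∀ m n → (m <ᵇ suc n) ≡ (m ≤ᵇ n)
  <ᵇ-suc zero    n = refl
  <ᵇ-suc (suc m) n = refl

⟦_⟧ : ∀ {n} → (ℕ → Bool) → Subset n
⟦ g ⟧ = tabulate (g ∘ toℕ)

∣⟦⟧∣ : ∀ n (g : ℕ → Bool) → ∣ ⟦_⟧ {n} g ∣ ≡ ∑[ i < n ] 𝟙 (g i)
∣⟦⟧∣ zero    g = refl
∣⟦⟧∣ (suc n) g with g 0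
... | true  = cong suc (∣⟦⟧∣ n (g ∘ suc))
... | false = ∣⟦⟧∣ n (g ∘ suc)

∈⟦⟧ : ∀ {n} (g : ℕ → Bool) {i : Fin n} → i ∈ ⟦ g ⟧ → T (g (toℕ i))
∈⟦⟧ g {i} i∈ = Equivalence.from T-≡ (trans (sym (lookup∘tabulate (g ∘ toℕ) i)) ([]=⇒lookup i∈))

_∈ᵇ_ : ∀ {n} → ℕ → Subset n → Bool
_     ∈ᵇ []      = false
zero  ∈ᵇ (x ∷ p) = x
suc c ∈ᵇ (x ∷ p) = c ∈ᵇ p

∣p∣≡∑∈ᵇ : ∀ {n} (p : Subset n) → ∣ p ∣ ≡ ∑[ c < n ] 𝟙 (c ∈ᵇ p)
∣p∣≡∑∈ᵇ []            = refl
∣p∣≡∑∈ᵇ (inside  ∷ p) = cong suc (∣p∣≡∑∈ᵇ p)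
∣p∣≡∑∈ᵇ (outside ∷ p) = ∣p∣≡∑∈ᵇ p

∈ᵇ⇒Nonempty∩ : ∀ {n} (p q : Subset n) c → T (c ∈ᵇ p) → T (c ∈ᵇ q) → Nonempty (p ∩ q)
∈ᵇ⇒Nonempty∩ (inside ∷ p) (inside ∷ q) zero    _   _   = zero , here
∈ᵇ⇒Nonempty∩ (x ∷ p)      (y ∷ q)      (suc c) c∈p c∈q =
  let i , i∈p∩q = ∈ᵇ⇒Nonempty∩ p q c c∈p c∈q in suc i , there i∈p∩q

-- Katona's circle lemma

-- `f i` says that the arc {i, i + 1, …, i + k − 1} of the n-cycle belongs to the family;
-- the arcs starting at x and at x + d are disjoint exactly when k ≤ d ≤ n − k.
IntersectingArcs : ℕ → ℕ → (ℕ → Bool) → Set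
IntersectingArcs k n f = ∀ {x d} → k ≤ d → d + k ≤ n → T (f x) → T (f (x + d)) → ⊥

-- With n = 2k + e, the arcs k, …, k + e are disjoint from the arc 0, and the remaining arcs pair
-- up as 1 + i and 1 + i + (k + e) with i < k − 1, two disjoint arcs.
katona-anchored : ∀ {k n} (f : ℕ → Bool) → 2 * k ≤ n → IntersectingArcs k n f → T (f 0) →
                  ∑[ i < n ] 𝟙 (f i) ≤ k
katona-anchored {zero}   f _    intersecting f0 = ⊥-elim (intersecting z≤n z≤n f0 f0)
katona-anchored {suc k′} f 2k≤n intersecting f0 with m≤n⇒∃[o]m+o≡n 2k≤n
... | e , refl = begin
  ∑ (2 * k + e) F
    ≡⟨ cong (λ l → ∑ l F) (2k+e≡k+[1+e+k′] k′ e) ⟩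
  ∑ (k + (suc e + k′)) F
    ≡⟨ ∑-split k (suc e + k′) F ⟩
  ∑ k F + ∑[ i < suc e + k′ ] F (k + i)
    ≡⟨ cong (∑ k F +_) (∑-split (suc e) k′ (λ i → F (k + i))) ⟩
  ∑ k F + (∑[ i < suc e ] F (k + i) + ∑[ i < k′ ] F (k + (suc e + i)))
    ≡⟨ cong (λ s → ∑ k F + (s + ∑[ i < k′ ] F (k + (suc e + i)))) opposite-arcs-absent ⟩
  F 0 + ∑[ i < k′ ] F (suc i) + ∑[ i < k′ ] F (k + (suc e + i))
    ≡⟨ +-assoc (F 0) _ _ ⟩
  F 0 + (∑[ i < k′ ] F (suc i) + ∑[ i < k′ ] F (k + (suc e + i)))
    ≡⟨ cong (F 0 +_) (∑-distrib-+ k′ _ _) ⟨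
  F 0 + ∑[ i < k′ ] (F (suc i) + F (k + (suc e + i)))
    ≤⟨ +-mono-≤ (𝟙≤1 (f 0)) (∑-≤1 k′ (λ _ → 𝟙-exclusive pair-disjoint)) ⟩
  1 + k′ ∎
  where
  open ≤-Reasoning
  k : ℕ
  k = suc k′
  F : ℕ → ℕ
  F = 𝟙 ∘ f
  2k+e≡k+[1+e+k′] : ∀ k′ e → 2 * suc k′ + e ≡ suc k′ + (suc e + k′)
  2k+e≡k+[1+e+k′] = solve-∀
  [k+e]+k≡2k+e : ∀ k′ e → suc k′ + e + suc k′ ≡ 2 * suc k′ + e
  [k+e]+k≡2k+e = solve-∀
  k+[1+e+i]≡1+i+[k+e] : ∀ k′ e i → suc k′ + (suc e + i) ≡ suc i + (suc k′ + e)
  k+[1+e+i]≡1+i+[k+e] = solve-∀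
  opposite-arcs-absent : ∑[ i < suc e ] F (k + i) ≡ 0
  opposite-arcs-absent = ∑-≡0 (suc e) (λ {i} i≤e → ¬T⇒𝟙≡0 (intersecting (m≤m+n k i)
    (≤-trans (+-monoˡ-≤ k (+-monoʳ-≤ k (s≤s⁻¹ i≤e))) (≤-reflexive ([k+e]+k≡2k+e k′ e))) f0))
  pair-disjoint : ∀ {i} → T (f (suc i)) → T (f (k + (suc e + i))) → ⊥
  pair-disjoint {i} f[1+i] f[k+1+e+i] = intersecting (m≤m+n k e) (≤-reflexive ([k+e]+k≡2k+e k′ e))
    f[1+i] (subst (T ∘ f) (k+[1+e+i]≡1+i+[k+e] k′ e i) f[k+1+e+i])

katona : ∀ {k n} (f : ℕ → Bool) → 2 * k ≤ n → (∀ i → f (i + n) ≡ f i) → IntersectingArcs k n f →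
         ∑[ i < n ] 𝟙 (f i) ≤ k
katona {k} {n} f 2k≤n periodic intersecting with ∑𝟙≡0⊎∃T n f
... | inj₁ ∑≡0     = subst (_≤ k) (sym ∑≡0) z≤n
... | inj₂ (a , fa) = begin
  ∑[ i < n ] 𝟙 (f i)       ≡⟨ ∑-rotate n (𝟙 ∘ f) (cong 𝟙 ∘ periodic) a ⟨
  ∑[ i < n ] 𝟙 (f (a + i)) ≤⟨ katona-anchored (λ i → f (a + i)) 2k≤n rotated fa′ ⟩
  k                        ∎
  where
  open ≤-Reasoning
  fa′ : T (f (a + 0))
  fa′ = subst (T ∘ f) (sym (+-identityʳ a)) fa
  rotated : IntersectingArcs k n (λ i → f (a + i))
  rotated k≤d d+k≤n fx fx+d = intersecting k≤d d+k≤n fx (subst (T ∘ f) (sym (+-assoc a _ _)) fx+d)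

[m+n]∸[o+p]≤[m∸o]+[n∸p] : ∀ m n o p → (m + n) ∸ (o + p) ≤ (m ∸ o) + (n ∸ p)
[m+n]∸[o+p]≤[m∸o]+[n∸p] m n o p = begin
  (m + n) ∸ (o + p)                        ≤⟨ ∸-monoˡ-≤ (o + p) (+-mono-≤ (m≤n+m∸n m o) (m≤n+m∸n n p)) ⟩
  (o + (m ∸ o)) + (p + (n ∸ p)) ∸ (o + p)  ≡⟨ cong (_∸ (o + p)) (interchange o (m ∸ o) p (n ∸ p)) ⟩
  (o + p) + ((m ∸ o) + (n ∸ p)) ∸ (o + p)  ≡⟨ m+n∸m≡n (o + p) _ ⟩
  (m ∸ o) + (n ∸ p)                        ∎
  where open ≤-Reasoning

n[qk∸r]≤ku⇒qn∸nr/k≤u : ∀ n q r k u .{{_ : NonZero k}} →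
                        n * (q * k ∸ r) ≤ k * u → q * n ∸ n * r / k ≤ u
n[qk∸r]≤ku⇒qn∸nr/k≤u n q r k u n[qk∸r]≤ku = s≤s⁻¹ (*-cancelˡ-< k _ _ (begin-strict
  k * (q * n ∸ F)                  ≡⟨ *-distribˡ-∸ k (q * n) F ⟩
  k * (q * n) ∸ k * F              ≤⟨ m≤n+m∸n _ R ⟩
  R + (k * (q * n) ∸ k * F ∸ R)    ≡⟨ cong (R +_) (∸-+-assoc (k * (q * n)) (k * F) R) ⟩
  R + (k * (q * n) ∸ (k * F + R))  ≡⟨ cong (λ x → R + (k * (q * n) ∸ x)) nr≡kF+R ⟨
  R + (k * (q * n) ∸ n * r)        ≡⟨ cong (R +_) kqn∸nr≡n[qk∸r] ⟩
  R + n * (q * k ∸ r)              <⟨ +-mono-<-≤ (m%n<n (n * r) k) n[qk∸r]≤ku ⟩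
  k + k * u                        ≡⟨ *-suc k u ⟨
  k * suc u                        ∎))
  where
  open ≤-Reasoning
  F R : ℕ
  F = n * r / k
  R = n * r % k
  nr≡kF+R : n * r ≡ k * F + R
  nr≡kF+R = trans (m≡m%n+[m/n]*n (n * r) k) (trans (+-comm R (F * k)) (cong (_+ R) (*-comm F k)))
  kqn≡nqk : ∀ k q n → k * (q * n) ≡ n * (q * k)
  kqn≡nqk = solve-∀
  kqn∸nr≡n[qk∸r] : k * (q * n) ∸ n * r ≡ n * (q * k ∸ r)
  kqn∸nr≡n[qk∸r] = trans (cong (_∸ n * r) (kqn≡nqk k q n)) (sym (*-distribˡ-∸ n (q * k) r))

m+[n+o]≤p⇒m+n+o≤p : ∀ m n {o p} → m + (n + o) ≤ p → m + n + o ≤ p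
m+[n+o]≤p⇒m+n+o≤p m n {o} = ≤-trans (≤-reflexive (+-assoc m n o))

m+[n+o]≤p⇒m+n≤p : ∀ m n {o p} → m + (n + o) ≤ p → m + n ≤ p
m+[n+o]≤p⇒m+n≤p m n {o} m+[n+o]≤p = m+n≤o⇒m≤o (m + n) (m+[n+o]≤p⇒m+n+o≤p m n m+[n+o]≤p)

m%n<k⇒k≤[m+d]%n : ∀ {n k d} .{{_ : NonZero n}} m → k ≤ d → d + k ≤ n → m % n < k → k ≤ (m + d) % n
m%n<k⇒k≤[m+d]%n {n} {k} {d} m k≤d d+k≤n m%n<k = begin
  k                     ≤⟨ k≤d ⟩
  d                     ≤⟨ m≤n+m d (m % n) ⟩
  m % n + d             ≡⟨ m<n⇒m%n≡m m%n+d<n ⟨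
  (m % n + d) % n       ≡⟨ cong (λ r → (m % n + r) % n) (m<n⇒m%n≡m d<n) ⟨
  (m % n + d % n) % n   ≡⟨ %-distribˡ-+ m d n ⟨
  (m + d) % n           ∎
  where
  open ≤-Reasoning
  m%n+d<n : m % n + d < n
  m%n+d<n = <-≤-trans (+-monoˡ-< d m%n<k) (≤-trans (≤-reflexive (+-comm k d)) d+k≤n)
  d<n : d < n
  d<n = <-≤-trans (m<m+n d (≤-<-trans z≤n m%n<k)) d+k≤n

-- The window [o, o + n′) of [n] read as a cycle of length n′: `arc s` consists of the positions
-- o + y with (s + y) mod n′ < k, i.e. of the k consecutive positions starting at −s (mod n′).
module Window (n k o n′ : ℕ) .{{_ : NonZero n′}} where

  onArc : ℕ → ℕ → Bool
  onArc s y = (y <ᵇ n′) ∧ ((s + y) % n′ <ᵇ k)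

  onWindowArc : ℕ → ℕ → Bool
  onWindowArc s z = (o ≤ᵇ z) ∧ onArc s (z ∸ o)

  arc : ℕ → Subset n
  arc s = ⟦ onWindowArc s ⟧

  ∣arc∣ : k ≤ n′ → o + n′ ≤ n → ∀ s → ∣ arc s ∣ ≡ k
  ∣arc∣ k≤n′ fits s = begin
    ∣ arc s ∣
      ≡⟨ ∣⟦⟧∣ n _ ⟩
    ∑[ z < n ] 𝟙 (onWindowArc s z)
      ≡⟨ cong (λ l → ∑[ z < l ] 𝟙 (onWindowArc s z)) (m+[n∸m]≡n o≤n) ⟨
    ∑[ z < o + (n ∸ o) ] 𝟙 ((o ≤ᵇ z) ∧ onArc s (z ∸ o))
      ≡⟨ ∑𝟙≤ᵇ∧ o (onArc s) ⟩
    ∑[ y < n ∸ o ] 𝟙 (onArc s y)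
      ≡⟨ ∑𝟙<ᵇ∧ (λ y → (s + y) % n′ <ᵇ k) n′≤n∸o ⟩
    ∑[ y < n′ ] 𝟙 ((s + y) % n′ <ᵇ k)
      ≡⟨ ∑-rotate n′ (λ y → 𝟙 (y % n′ <ᵇ k)) periodic s ⟩
    ∑[ y < n′ ] 𝟙 (y % n′ <ᵇ k)
      ≡⟨ ∑-cong n′ (λ y<n′ → cong (λ r → 𝟙 (r <ᵇ k)) (m<n⇒m%n≡m y<n′)) ⟩
    ∑[ y < n′ ] 𝟙 (y <ᵇ k)
      ≡⟨ ∑𝟙<ᵇ k≤n′ ⟩
    k ∎
    where
    open ≡-Reasoning
    o≤n : o ≤ n
    o≤n = ≤-trans (m≤m+n o n′) fits
    n′≤n∸o : n′ ≤ n ∸ o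
    n′≤n∸o = m+n≤o⇒m≤o∸n n′ (≤-trans (≤-reflexive (+-comm n′ o)) fits)
    periodic : ∀ y → 𝟙 ((y + n′) % n′ <ᵇ k) ≡ 𝟙 (y % n′ <ᵇ k)
    periodic y = cong (λ r → 𝟙 (r <ᵇ k)) ([m+n]%n≡m%n y n′)

  arc-periodic : ∀ s → arc (s + n′) ≡ arc s
  arc-periodic s = tabulate-cong (λ i → cong (λ r → (o ≤ᵇ toℕ i) ∧ ((toℕ i ∸ o <ᵇ n′) ∧ (r <ᵇ k)))
    (trans (cong (_% n′) (xy∙z≈xz∙y s n′ (toℕ i ∸ o))) ([m+n]%n≡m%n (s + (toℕ i ∸ o)) n′)))

  ∈arc⇒ : ∀ {s} {i : Fin n} → i ∈ arc s →
          o ≤ toℕ i × toℕ i ∸ o < n′ × (s + (toℕ i ∸ o)) % n′ < k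
  ∈arc⇒ {s} {i} i∈arc =
    let o≤i , i∈cycle = Equivalence.to (T-∧ {o ≤ᵇ toℕ i}) (∈⟦⟧ (onWindowArc s) i∈arc)
        i∸o<n′ , i∈arc = Equivalence.to (T-∧ {toℕ i ∸ o <ᵇ n′}) i∈cycle
    in ≤ᵇ⇒≤ o (toℕ i) o≤i , <ᵇ⇒< _ n′ i∸o<n′ , <ᵇ⇒< _ k i∈arc

  arc⊆window : ∀ {s} {i : Fin n} → i ∈ arc s → o ≤ toℕ i × toℕ i < o + n′
  arc⊆window {i = i} i∈arc =
    let o≤i , i∸o<n′ , _ = ∈arc⇒ i∈arc
    in o≤i , ≤-<-trans (m≤n+m∸n (toℕ i) o) (+-monoʳ-< o i∸o<n′)

  arcs-disjoint : ∀ {s d} → k ≤ d → d + k ≤ n′ → Disjoint (arc s) (arc (s + d))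
  arcs-disjoint {s} {d} k≤d d+k≤n′ (i , i∈∩) =
    let i∈arc[s] , i∈arc[s+d] = x∈p∩q⁻ (arc s) (arc (s + d)) i∈∩
        y = toℕ i ∸ o
    in <⇒≱ (proj₂ (proj₂ (∈arc⇒ i∈arc[s+d])))
         (subst (λ x → k ≤ x % n′) (xy∙z≈xz∙y s y d)
           (m%n<k⇒k≤[m+d]%n (s + y) k≤d d+k≤n′ (proj₂ (proj₂ (∈arc⇒ i∈arc[s])))))

-- Colourings of K(n, k)

module _ {n k N m : ℕ} .{{_ : NonZero k}} (C : Colouring (Kneser n k) N m) where
  open Colouring C

  module WindowColours (o n′ : ℕ) (2k≤n′ : 2 * k ≤ n′) (fits : o + n′ ≤ n) where

    k≤n′ : k ≤ n′
    k≤n′ = ≤-trans (m≤m+n k _) 2k≤n′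

    instance
      n′-nonZero : NonZero n′
      n′-nonZero = >-nonZero (<-≤-trans (>-nonZero⁻¹ k) k≤n′)

    open Window n k o n′ public

    vertex : ℕ → KSubset n k
    vertex s = arc s , ∣arc∣ k≤n′ fits s

    vertex-periodic : ∀ s → vertex (s + n′) ≡ vertex s
    vertex-periodic s = Σ-≡,≡→≡ (arc-periodic s , ≡-irrelevant _ _)

    occurrences : ℕ → ℕ
    occurrences c = ∑[ s < n′ ] 𝟙 (c ∈ᵇ colour (vertex s))

    occurrences≤k : ∀ c → occurrences c ≤ k
    occurrences≤k c = katona (λ s → c ∈ᵇ colour (vertex s)) 2k≤n′
      (λ s → cong (λ v → c ∈ᵇ colour v) (vertex-periodic s))
      (λ {x} {d} k≤d d+k≤n′ c∈x c∈x+d →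
         proper (vertex x) (vertex (x + d)) (arcs-disjoint k≤d d+k≤n′) (∈ᵇ⇒Nonempty∩ _ _ c c∈x c∈x+d))

    uses : ℕ → ℕ
    uses c = 𝟙 (0 <ᵇ occurrences c)

    uses-lowerBound : n′ * m ≤ k * ∑[ c < N ] uses c
    uses-lowerBound = begin
      n′ * m                                              ≡⟨ ∑-const n′ m ⟨
      ∑[ s < n′ ] m                                       ≡⟨ ∑-cong n′ (λ {s} _ → ∣colour∣ s) ⟩
      ∑[ s < n′ ] ∑[ c < N ] 𝟙 (c ∈ᵇ colour (vertex s))   ≡⟨ ∑-comm n′ N _ ⟩
      ∑[ c < N ] occurrences c                            ≤⟨ ∑-mono-≤ N (λ {c} _ → occurrences≤k*uses c) ⟩
      ∑[ c < N ] (k * uses c)                             ≡⟨ *-distribˡ-∑ k N uses ⟨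
      k * ∑[ c < N ] uses c                               ∎
      where
      open ≤-Reasoning
      occurrences≤k*uses : ∀ c → occurrences c ≤ k * uses c
      occurrences≤k*uses c = m≤n⇒m≤n*𝟙[0<m] (occurrences≤k c)
      ∣colour∣ : ∀ s → m ≡ ∑[ c < N ] 𝟙 (c ∈ᵇ colour (vertex s))
      ∣colour∣ s = trans (sym (size (vertex s))) (∣p∣≡∑∈ᵇ (colour (vertex s)))

    uses-vanish : ∀ {c} (v : KSubset n k) → T (c ∈ᵇ colour v) → (∀ {i} → i ∈ proj₁ v → toℕ i < o) →
                  uses c ≡ 0
    uses-vanish {c} v c∈v v<o = cong (λ x → 𝟙 (0 <ᵇ x)) (∑-≡0 n′ (λ {s} _ → ¬T⇒𝟙≡0 (λ c∈s →
      proper v (vertex s) (apart s) (∈ᵇ⇒Nonempty∩ _ _ c c∈v c∈s))))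
      where
      apart : ∀ s → Disjoint (proj₁ v) (arc s)
      apart s (i , i∈∩) = let i∈v , i∈s = x∈p∩q⁻ _ _ i∈∩ in <⇒≱ (v<o i∈v) (proj₁ (arc⊆window i∈s))

  module LeadingWindow (o n′ : ℕ) {l} (2k≤n′ : 2 * k ≤ n′) (fits : o + (n′ + l) ≤ n) =
    WindowColours o n′ 2k≤n′ (m+[n+o]≤p⇒m+n≤p o n′ fits)

  windowsUsing : (o : ℕ) (ns : List ℕ) → All (λ n′ → 2 * k ≤ n′) ns → o + sum ns ≤ n → ℕ → ℕ
  windowsUsing o []        []       _    c = 0
  windowsUsing o (n′ ∷ ns) (p ∷ ps) fits c =
    LeadingWindow.uses o n′ p fits c
      + windowsUsing (o + n′) ns ps (m+[n+o]≤p⇒m+n+o≤p o n′ fits) c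

  windowsUsing≡0 : ∀ {c} (v : KSubset n k) → T (c ∈ᵇ colour v) →
                   ∀ {o} → (∀ {i} → i ∈ proj₁ v → toℕ i < o) →
                   ∀ ns ps fits → windowsUsing o ns ps fits c ≡ 0
  windowsUsing≡0 v c∈v v<o []        []       _    = refl
  windowsUsing≡0 v c∈v {o} v<o (n′ ∷ ns) (p ∷ ps) fits = cong₂ _+_
    (LeadingWindow.uses-vanish o n′ p fits v c∈v v<o)
    (windowsUsing≡0 v c∈v (λ i∈v → <-≤-trans (v<o i∈v) (m≤m+n o n′)) ns ps _)

  windowsUsing≤1 : ∀ o ns ps fits c → windowsUsing o ns ps fits c ≤ 1
  windowsUsing≤1 o []        []       _    c = z≤n
  windowsUsing≤1 o (n′ ∷ ns) (p ∷ ps) fits c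
    with ∑𝟙≡0⊎∃T n′ (λ s → c ∈ᵇ colour (LeadingWindow.vertex o n′ p fits s))
  ... | inj₁ unused    = subst (λ x → 𝟙 (0 <ᵇ x) + _ ≤ 1) (sym unused) (windowsUsing≤1 (o + n′) ns ps _ c)
  ... | inj₂ (s , c∈s) = begin
    W.uses c + windowsUsing (o + n′) ns ps _ c
      ≡⟨ cong (W.uses c +_) (windowsUsing≡0 (W.vertex s) c∈s before ns ps _) ⟩
    W.uses c + 0
      ≡⟨ +-identityʳ _ ⟩
    W.uses c
      ≤⟨ 𝟙≤1 _ ⟩
    1 ∎
    where
    open ≤-Reasoning
    module W = LeadingWindow o n′ p fits
    before : ∀ {i} → i ∈ proj₁ (W.vertex s) → toℕ i < o + n′
    before i∈s = proj₂ (W.arc⊆window i∈s)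

  ∑windowsUsing-lowerBound : ∀ q r → m ≡ q * k ∸ r → ∀ o ns ps fits →
                             q * sum ns ∸ floorSum ns r k ≤ ∑[ c < N ] windowsUsing o ns ps fits c
  ∑windowsUsing-lowerBound q r m≡qk∸r o []        []       _    = ≤-trans (≤-reflexive (*-zeroʳ q)) z≤n
  ∑windowsUsing-lowerBound q r m≡qk∸r o (n′ ∷ ns) (p ∷ ps) fits = begin
    q * (n′ + sum ns) ∸ (n′ * r / k + floorSum ns r k)
      ≡⟨ cong (_∸ (n′ * r / k + floorSum ns r k)) (*-distribˡ-+ q n′ (sum ns)) ⟩
    (q * n′ + q * sum ns) ∸ (n′ * r / k + floorSum ns r k)
      ≤⟨ [m+n]∸[o+p]≤[m∸o]+[n∸p] (q * n′) (q * sum ns) (n′ * r / k) (floorSum ns r k) ⟩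
    (q * n′ ∸ n′ * r / k) + (q * sum ns ∸ floorSum ns r k)
      ≤⟨ +-mono-≤ leading (∑windowsUsing-lowerBound q r m≡qk∸r (o + n′) ns ps _) ⟩
    ∑[ c < N ] W.uses c + ∑[ c < N ] windowsUsing (o + n′) ns ps _ c
      ≡⟨ ∑-distrib-+ N W.uses _ ⟨
    ∑[ c < N ] windowsUsing o (n′ ∷ ns) (p ∷ ps) fits c ∎
    where
    open ≤-Reasoning
    module W = LeadingWindow o n′ p fits
    leading : q * n′ ∸ n′ * r / k ≤ ∑[ c < N ] W.uses c
    leading = n[qk∸r]≤ku⇒qn∸nr/k≤u n′ q r k _
      (subst (λ x → n′ * x ≤ k * ∑[ c < N ] W.uses c) m≡qk∸r W.uses-lowerBound)

theorem1p6 : (n k r q : ℕ) → (h2k : 2 ≤ 2 * k) → 2 * k ≤ n → 1 ≤ q → r ≤ k ∸ 1 →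
    (ns : List ℕ) → sum ns ≡ n → All (λ ni → 2 * k ≤ ni × ni < 4 * k) ns →
    (N : ℕ) → Colourable (Kneser n k) N (q * k ∸ r) →
    q * n ∸ floorSum ns r k {{2≤2k⇒NonZero h2k}} ≤ N
theorem1p6 _ zero      _ _ () _ _ _ _  _    _      _ _
theorem1p6 _ k@(suc _) r q _  _ _ _ ns refl bounds N C = begin
  q * sum ns ∸ floorSum ns r k  ≤⟨ ∑windowsUsing-lowerBound C q r refl 0 ns 2k≤ns ≤-refl ⟩
  ∑[ c < N ] windows c          ≤⟨ ∑-≤1 N (λ {c} _ → windowsUsing≤1 C 0 ns 2k≤ns ≤-refl c) ⟩
  N                             ∎
  where
  open ≤-Reasoning
  2k≤ns : All (λ nᵢ → 2 * k ≤ nᵢ) ns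
  2k≤ns = All.map proj₁ bounds
  windows : ℕ → ℕ
  windows = windowsUsing C 0 ns 2k≤ns ≤-refl
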